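{- Let $t>0$, $n=3^t-1$, $\nu=n/2$, let $\Lambda_n$, $\Phi$ be as in the context, and let $C\subseteq\mathbb{Z}_3^\nu$ be a ternary perfect single-error-correcting code of length $\nu$ which is linear (a subspace of $\mathbb{Z}_3^\nu$). Then $T_n=\Phi(C)+\Lambda_n$ is a lattice tiling of $\mathbb{Z}^n$ with $\Upsilon_n$, i.e. $T_n$ is a lattice in $\mathbb{R}^n$ and an integer tiling with $\Upsilon_n$.
   Context: $e_r$ is the $r$-th unit vector. $\Lambda_n\subseteq\mathbb{Z}^n$ is the lattice generated by $\{3e_{2i-1}+2e_{2i}:1\le i\le\nu\}\cup\{4e_{2i}:1\le i\le\nu\}$. $\phi:\mathbb{Z}_3\to\mathbb{Z}^2$ is given by $\phi(0)=(0,0)$, $\phi(1)=(1,2)$, $\phi(2)=(2,0)$ and $\Phi(x_1,\dots,x_\nu)=(\phi(x_1),\dots,\phi(x_\nu))\in\mathbb{Z}^n$; $\Phi(C)+\Lambda_n=\{\Phi(c)+Y:c\in C,Y\in\Lambda_n\}$. A ternary perfect single-error-correcting code of length $\nu$ is a set $C\subseteq\mathbb{Z}_3^\nu$ with pairwise Hamming distance at least $3$ such that every word is within Hamming distance $1$ of a codeword. $\Upsilon_n=\{U\in\mathbb{Z}^n:\sum_i|x_i-u_i|\le1\text{ for some }X\in\{ -1,0\}^n\}$; $T\subseteq\mathbb{Z}^n$ is an integer tiling with $\Upsilon_n$ if the translates $X+\Upsilon_n$, $X\in T$, partition $\mathbb{Z}^n$. -}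

module Defs where

open import Data.Nat as ℕ using (ℕ; zero; suc)
open import Data.Integer as ℤ using (ℤ; +_; -[1+_]; ∣_∣)
open import Data.Fin using (Fin; zero; suc; combine; remQuot)
open import Data.Fin.Properties using (_≟_)
open import Data.Product using (Σ; ∃; _×_; _,_)
open import Data.Sum using (_⊎_)
open import Relation.Nullary using (¬_; yes; no)
open import Relation.Binary.PropositionalEquality using (_≡_)

_+₃_ : Fin 3 → Fin 3 → Fin 3
zero +₃ b = b
suc zero +₃ zero = suc zero
suc zero +₃ suc zero = suc (suc zero)
suc zero +₃ suc (suc zero) = zero
suc (suc zero) +₃ zero = suc (suc zero)
suc (suc zero) +₃ suc zero = zero
suc (suc zero) +₃ suc (suc zero) = suc zero

_*₃_ : Fin 3 → Fin 3 → Fin 3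
zero *₃ b = zero
suc zero *₃ b = b
suc (suc zero) *₃ zero = zero
suc (suc zero) *₃ suc zero = suc (suc zero)
suc (suc zero) *₃ suc (suc zero) = suc zero

Word : ℕ → Set
Word ν = Fin ν → Fin 3

Code : ℕ → Set₁
Code ν = Word ν → Set

hamming : ∀ {ν} → Word ν → Word ν → ℕ
hamming {zero} x y = 0
hamming {suc ν} x y with x zero ≟ y zero
... | yes _ = hamming (λ i → x (suc i)) (λ i → y (suc i))
... | no _ = suc (hamming (λ i → x (suc i)) (λ i → y (suc i)))

PerfectCode : ∀ ν → Code ν → Set
PerfectCode ν C =
  (∀ c c' → C c → C c' → ¬ (∀ i → c i ≡ c' i) → 3 ℕ.≤ hamming c c')
  × (∀ (w : Word ν) → ∃ λ c → C c × hamming w c ℕ.≤ 1)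

Linear : ∀ ν → Code ν → Set
Linear ν C =
  C (λ _ → zero)
  × (∀ c c' → C c → C c' → C (λ i → c i +₃ c' i))
  × (∀ (s : Fin 3) c → C c → C (λ i → s *₃ c i))

-- points of Z^n with n = 2ν; coordinates indexed by Fin (ν * 2)
-- coordinate (2i-1) (1-indexed) is combine i 0, coordinate 2i is combine i 1
Pt : ℕ → Set
Pt n = Fin n → ℤ

odd' : ∀ {ν} → Fin ν → Fin (ν ℕ.* 2)
odd' i = combine i zero

even' : ∀ {ν} → Fin ν → Fin (ν ℕ.* 2)
even' i = combine i (suc zero)

-- membership in Λ_n : integer combination Σ α_i (3e_{2i-1}+2e_{2i}) + β_i (4 e_{2i})
InΛ : ∀ ν → Pt (ν ℕ.* 2) → Set
InΛ ν X = ∃ λ (α : Fin ν → ℤ) → ∃ λ (β : Fin ν → ℤ) →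
  ∀ i → (X (odd' i) ≡ + 3 ℤ.* α i)
        × (X (even' i) ≡ + 2 ℤ.* α i ℤ.+ + 4 ℤ.* β i)

φ₁ φ₂ : Fin 3 → ℤ
φ₁ zero = + 0
φ₁ (suc zero) = + 1
φ₁ (suc (suc zero)) = + 2
φ₂ zero = + 0
φ₂ (suc zero) = + 2
φ₂ (suc (suc zero)) = + 0

Φ : ∀ {ν} → Word ν → Pt (ν ℕ.* 2)
Φ x j with remQuot 2 j
... | i , zero = φ₁ (x i)
... | i , suc zero = φ₂ (x i)

InT : ∀ ν → Code ν → Pt (ν ℕ.* 2) → Set
InT ν C X = ∃ λ c → ∃ λ Y → C c × InΛ ν Y × (∀ j → X j ≡ Φ c j ℤ.+ Y j)

sumFin : ∀ n → (Fin n → ℕ) → ℕ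
sumFin zero f = 0
sumFin (suc n) f = f zero ℕ.+ sumFin n (λ i → f (suc i))

InΥ : ∀ n → Pt n → Set
InΥ n U = ∃ λ (X : Pt n) → (∀ i → X i ≡ -[1+ 0 ] ⊎ X i ≡ + 0)
          × sumFin n (λ i → ∣ X i ℤ.- U i ∣) ℕ.≤ 1

IntegerTiling : ∀ n → (Pt n → Set) → Set
IntegerTiling n T =
  (∀ (Z : Pt n) → ∃ λ X → T X × InΥ n (λ i → Z i ℤ.- X i))
  × (∀ (Z X X' : Pt n) → T X → T X' → InΥ n (λ i → Z i ℤ.- X i) → InΥ n (λ i → Z i ℤ.- X' i)
       → ∀ i → X i ≡ X' i)

-- T is a lattice: an additive subgroup of Z^n (discrete automatically)
IsLattice : ∀ n → (Pt n → Set) → Set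
IsLattice n T =
  T (λ _ → + 0)
  × (∀ X Y → T X → T Y → T (λ i → X i ℤ.+ Y i))
  × (∀ X → T X → T (λ i → ℤ.- X i))
  × (∀ X Y → (∀ i → X i ≡ Y i) → T X → T Y)

-- Everything happens one coordinate pair at a time.  The residue map ρ(x₁,x₂) = 2x₁ + 3x₂
-- identifies ℤ²/Λ₂ with ℤ/12: a pair lies in Λ₂ iff 12 divides its residue.  So X ∈ T iff
-- for some c ∈ C every pair of X has residue ψ(cᵢ) = ρ(φ(cᵢ)) ∈ {0, 8, 4} modulo 12, and
-- linearity of C makes T closed under + and −, i.e. a lattice.
-- For the tiling, two finite facts about ℤ/12 carry all the geometry:
--   (a) the 12 points of the planar tile Υ₂ have pairwise distinct residues, and
--   (b) the corners {-1,0}² of Υ₂ shifted by ψ(0), ψ(1), ψ(2) hit every residue exactly once.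
-- By (b) each pair of a point Z has a "nearest symbol", so Z determines a received word w.
-- Writing Z = X + u with X ≡ Φ(c) forces, by (a), a unique u with all pairs in Υ₂, and the
-- total distance of u from the corners is exactly hamming(w, c).  So Z is covered by the
-- translates at codewords c with hamming(w, c) ≤ 1: perfection of C gives one such c
-- (existence) and only one (uniqueness).
module Submission where

open import Defs
open import Data.Nat using (ℕ; _<_; _^_; _*_; _+_)
open import Data.Product using (_×_)
open import Relation.Binary.PropositionalEquality using (_≡_)

open import Data.Nat as ℕ using (zero; suc; z≤n; s≤s; _≤_; _≤?_; NonZero)
import Data.Nat.Properties as ℕP
open import Algebra.Properties.CommutativeSemigroup ℕP.+-commutativeSemigroup using (interchange)
open import Data.Integer as ℤ using (ℤ; +_; -[1+_]; ∣_∣)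
import Data.Integer.Properties as ℤP
open import Data.Integer.DivMod using (_%ℕ_; _/ℕ_; n%ℕd<d; a≡a%ℕn+[a/ℕn]*n)
open import Data.Integer.Divisibility.Signed using (_∣_; divides; _∣?_; ∣m∣n⇒∣m+n; ∣m⇒∣-m)
open import Data.Integer.Tactic.RingSolver using (solve-∀)
open import Data.Fin using (Fin; zero; suc; toℕ; fromℕ<; combine; remQuot)
open import Data.Fin.Properties using (_≟_; all?; any?; remQuot-combine; combine-remQuot; toℕ-fromℕ<)
open import Data.Product using (∃; ∃₂; _,_; proj₁; proj₂)
open import Data.Sum using (_⊎_; inj₁; inj₂)
open import Data.Empty using (⊥-elim)
open import Relation.Nullary using (Dec; yes; no)
open import Relation.Nullary.Decidable using (from-yes; map′; _→-dec_; _×-dec_)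
open import Relation.Binary.PropositionalEquality using (refl; sym; trans; cong; cong₂; subst; subst₂; module ≡-Reasoning)

infix 4 _≡_[mod_] _≡?_[mod_]

-- x ≡ y [mod m]: m divides x − y.  (A record rather than a definition, so that x and y
-- can be inferred from a congruence.)
record _≡_[mod_] (x y m : ℤ) : Set where
  constructor congruent
  field
    divides-difference : m ∣ x ℤ.- y
open _≡_[mod_]

_≡?_[mod_] : ∀ x y m → Dec (x ≡ y [mod m ])
x ≡? y [mod m ] = map′ congruent divides-difference (m ∣? (x ℤ.- y))

module _ {m : ℤ} where

  mod-reflexive : ∀ {x y} → x ≡ y → x ≡ y [mod m ]
  mod-reflexive {x} refl = congruent (divides (+ 0) (ℤP.+-inverseʳ x))

  mod-sym : ∀ {x y} → x ≡ y [mod m ] → y ≡ x [mod m ]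
  mod-sym {x} {y} (congruent m∣x-y) = congruent (subst (m ∣_) (identity x y) (∣m⇒∣-m m∣x-y))
    where
    identity : ∀ x y → ℤ.- (x ℤ.- y) ≡ y ℤ.- x
    identity = solve-∀

  mod-trans : ∀ {x y z} → x ≡ y [mod m ] → y ≡ z [mod m ] → x ≡ z [mod m ]
  mod-trans {x} {y} {z} (congruent m∣x-y) (congruent m∣y-z) =
    congruent (subst (m ∣_) (identity x y z) (∣m∣n⇒∣m+n m∣x-y m∣y-z))
    where
    identity : ∀ x y z → (x ℤ.- y) ℤ.+ (y ℤ.- z) ≡ x ℤ.- z
    identity = solve-∀

  mod-+ : ∀ {x x' y y'} → x ≡ x' [mod m ] → y ≡ y' [mod m ] → x ℤ.+ y ≡ x' ℤ.+ y' [mod m ]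
  mod-+ {x} {x'} {y} {y'} (congruent m∣x-x') (congruent m∣y-y') =
    congruent (subst (m ∣_) (identity x x' y y') (∣m∣n⇒∣m+n m∣x-x' m∣y-y'))
    where
    identity : ∀ x x' y y' → (x ℤ.- x') ℤ.+ (y ℤ.- y') ≡ (x ℤ.+ y) ℤ.- (x' ℤ.+ y')
    identity = solve-∀

  mod-neg : ∀ {x y} → x ≡ y [mod m ] → ℤ.- x ≡ ℤ.- y [mod m ]
  mod-neg {x} {y} (congruent m∣x-y) = congruent (subst (m ∣_) (identity x y) (∣m⇒∣-m m∣x-y))
    where
    identity : ∀ x y → ℤ.- (x ℤ.- y) ≡ ℤ.- x ℤ.- ℤ.- y
    identity = solve-∀

  mod-cancelʳ : ∀ {x y z} → x ℤ.+ z ≡ y ℤ.+ z [mod m ] → x ≡ y [mod m ]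
  mod-cancelʳ {x} {y} {z} (congruent m∣difference) = congruent (subst (m ∣_) (identity x y z) m∣difference)
    where
    identity : ∀ x y z → (x ℤ.+ z) ℤ.- (y ℤ.+ z) ≡ x ℤ.- y
    identity = solve-∀

  mod-move : ∀ {x y z} → x ℤ.- y ≡ z [mod m ] → x ≡ z ℤ.+ y [mod m ]
  mod-move {x} {y} {z} (congruent m∣difference) = congruent (subst (m ∣_) (identity x y z) m∣difference)
    where
    identity : ∀ x y z → (x ℤ.- y) ℤ.- z ≡ x ℤ.- (z ℤ.+ y)
    identity = solve-∀

residue-cover : ∀ m .{{_ : NonZero m}} (P : ℤ → Set) →
  (∀ {x y} → x ≡ y [mod + m ] → P y → P x) → (∀ (k : Fin m) → P (+ toℕ k)) → ∀ x → P x
residue-cover m P respects base x = respects x≡k (base k)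
  where
  open ≡-Reasoning
  r<m = n%ℕd<d x m
  k = fromℕ< r<m
  identity : ∀ r q M → (r ℤ.+ q ℤ.* M) ℤ.- r ≡ q ℤ.* M
  identity = solve-∀
  x≡k : x ≡ + toℕ k [mod + m ]
  x≡k = congruent (divides (x /ℕ m) (begin
    x ℤ.- + toℕ k                                 ≡⟨ cong (λ r → x ℤ.- + r) (toℕ-fromℕ< r<m) ⟩
    x ℤ.- + (x %ℕ m)                              ≡⟨ cong (ℤ._- + (x %ℕ m)) (a≡a%ℕn+[a/ℕn]*n x m) ⟩
    (+ (x %ℕ m) ℤ.+ (x /ℕ m) ℤ.* + m) ℤ.- + (x %ℕ m) ≡⟨ identity (+ (x %ℕ m)) (x /ℕ m) (+ m) ⟩
    (x /ℕ m) ℤ.* + m                              ∎))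

z-[z-u]≡u : ∀ z u → z ℤ.- (z ℤ.- u) ≡ u
z-[z-u]≡u = solve-∀

-- The residue map ρ(x₁, x₂) = 2x₁ + 3x₂ maps ℤ² onto ℤ/12 with kernel Λ₂ (below).
ρ : ℤ → ℤ → ℤ
ρ x₁ x₂ = + 2 ℤ.* x₁ ℤ.+ + 3 ℤ.* x₂

Λ₂ : ℤ → ℤ → Set
Λ₂ x₁ x₂ = ∃₂ λ α β → x₁ ≡ + 3 ℤ.* α × x₂ ≡ + 2 ℤ.* α ℤ.+ + 4 ℤ.* β

Λ₂⇒12∣ρ : ∀ {x₁ x₂} → Λ₂ x₁ x₂ → + 12 ∣ ρ x₁ x₂
Λ₂⇒12∣ρ (α , β , refl , refl) = divides (α ℤ.+ β) (identity α β)
  where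
  identity : ∀ α β → + 2 ℤ.* (+ 3 ℤ.* α) ℤ.+ + 3 ℤ.* (+ 2 ℤ.* α ℤ.+ + 4 ℤ.* β) ≡ (α ℤ.+ β) ℤ.* + 12
  identity = solve-∀

-- Conversely, from 2x₁ + 3x₂ = 12k one reads off α = x₁ + x₂ − 4k and β = x₁ + 2x₂ − 7k.
12∣ρ⇒Λ₂ : ∀ {x₁ x₂} → + 12 ∣ ρ x₁ x₂ → Λ₂ x₁ x₂
12∣ρ⇒Λ₂ {x₁} {x₂} (divides k ρ≡12k) = α , β , x₁≡ , x₂≡
  where
  open ≡-Reasoning
  α = x₁ ℤ.+ x₂ ℤ.- + 4 ℤ.* k
  β = x₁ ℤ.+ + 2 ℤ.* x₂ ℤ.- + 7 ℤ.* k
  x₁≡ : x₁ ≡ + 3 ℤ.* α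
  x₁≡ = begin
    x₁                                           ≡⟨ e₁ x₁ x₂ ⟩
    + 3 ℤ.* (x₁ ℤ.+ x₂) ℤ.- ρ x₁ x₂              ≡⟨ cong (λ r → + 3 ℤ.* (x₁ ℤ.+ x₂) ℤ.- r) ρ≡12k ⟩
    + 3 ℤ.* (x₁ ℤ.+ x₂) ℤ.- k ℤ.* + 12           ≡⟨ e₂ x₁ x₂ k ⟩
    + 3 ℤ.* α                                    ∎
    where
    e₁ : ∀ x₁ x₂ → x₁ ≡ + 3 ℤ.* (x₁ ℤ.+ x₂) ℤ.- (+ 2 ℤ.* x₁ ℤ.+ + 3 ℤ.* x₂)
    e₁ = solve-∀
    e₂ : ∀ x₁ x₂ k → + 3 ℤ.* (x₁ ℤ.+ x₂) ℤ.- k ℤ.* + 12 ≡ + 3 ℤ.* (x₁ ℤ.+ x₂ ℤ.- + 4 ℤ.* k)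
    e₂ = solve-∀
  x₂≡ : x₂ ≡ + 2 ℤ.* α ℤ.+ + 4 ℤ.* β
  x₂≡ = begin
    x₂                                           ≡⟨ e₁ x₁ x₂ ⟩
    + 6 ℤ.* x₁ ℤ.+ + 10 ℤ.* x₂ ℤ.- + 3 ℤ.* ρ x₁ x₂ ≡⟨ cong (λ r → + 6 ℤ.* x₁ ℤ.+ + 10 ℤ.* x₂ ℤ.- + 3 ℤ.* r) ρ≡12k ⟩
    + 6 ℤ.* x₁ ℤ.+ + 10 ℤ.* x₂ ℤ.- + 3 ℤ.* (k ℤ.* + 12) ≡⟨ e₂ x₁ x₂ k ⟩
    + 2 ℤ.* α ℤ.+ + 4 ℤ.* β                      ∎
    where
    e₁ : ∀ x₁ x₂ → x₂ ≡ + 6 ℤ.* x₁ ℤ.+ + 10 ℤ.* x₂ ℤ.- + 3 ℤ.* (+ 2 ℤ.* x₁ ℤ.+ + 3 ℤ.* x₂)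
    e₁ = solve-∀
    e₂ : ∀ x₁ x₂ k → + 6 ℤ.* x₁ ℤ.+ + 10 ℤ.* x₂ ℤ.- + 3 ℤ.* (k ℤ.* + 12)
                      ≡ + 2 ℤ.* (x₁ ℤ.+ x₂ ℤ.- + 4 ℤ.* k) ℤ.+ + 4 ℤ.* (x₁ ℤ.+ + 2 ℤ.* x₂ ℤ.- + 7 ℤ.* k)
    e₂ = solve-∀

ρ-+ : ∀ x₁ x₂ y₁ y₂ → ρ (x₁ ℤ.+ y₁) (x₂ ℤ.+ y₂) ≡ ρ x₁ x₂ ℤ.+ ρ y₁ y₂
ρ-+ = identity
  where
  identity : ∀ x₁ x₂ y₁ y₂ → + 2 ℤ.* (x₁ ℤ.+ y₁) ℤ.+ + 3 ℤ.* (x₂ ℤ.+ y₂)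
                              ≡ (+ 2 ℤ.* x₁ ℤ.+ + 3 ℤ.* x₂) ℤ.+ (+ 2 ℤ.* y₁ ℤ.+ + 3 ℤ.* y₂)
  identity = solve-∀

ρ-neg : ∀ x₁ x₂ → ρ (ℤ.- x₁) (ℤ.- x₂) ≡ ℤ.- ρ x₁ x₂
ρ-neg = identity
  where
  identity : ∀ x₁ x₂ → + 2 ℤ.* (ℤ.- x₁) ℤ.+ + 3 ℤ.* (ℤ.- x₂) ≡ ℤ.- (+ 2 ℤ.* x₁ ℤ.+ + 3 ℤ.* x₂)
  identity = solve-∀

ρ-- : ∀ x₁ x₂ y₁ y₂ → ρ (x₁ ℤ.- y₁) (x₂ ℤ.- y₂) ≡ ρ x₁ x₂ ℤ.- ρ y₁ y₂
ρ-- = identity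
  where
  identity : ∀ x₁ x₂ y₁ y₂ → + 2 ℤ.* (x₁ ℤ.- y₁) ℤ.+ + 3 ℤ.* (x₂ ℤ.- y₂)
                              ≡ (+ 2 ℤ.* x₁ ℤ.+ + 3 ℤ.* x₂) ℤ.- (+ 2 ℤ.* y₁ ℤ.+ + 3 ℤ.* y₂)
  identity = solve-∀

ρ-at : ∀ {ν} → Pt (ν * 2) → Fin ν → ℤ
ρ-at X i = ρ (X (odd' i)) (X (even' i))

fromPairs : ∀ {ν} → (Fin ν → ℤ) → (Fin ν → ℤ) → Pt (ν * 2)
fromPairs f g j with remQuot 2 j
... | i , zero = f i
... | i , suc zero = g i

fromPairs-odd : ∀ {ν} (f g : Fin ν → ℤ) i → fromPairs f g (odd' i) ≡ f i
fromPairs-odd {ν} f g i with remQuot {ν} 2 (odd' i) | remQuot-combine {ν} {2} i zero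
... | .(i , zero) | refl = refl

fromPairs-even : ∀ {ν} (f g : Fin ν → ℤ) i → fromPairs f g (even' i) ≡ g i
fromPairs-even {ν} f g i with remQuot {ν} 2 (even' i) | remQuot-combine {ν} {2} i (suc zero)
... | .(i , suc zero) | refl = refl

Φ-odd : ∀ {ν} (c : Word ν) i → Φ c (odd' i) ≡ φ₁ (c i)
Φ-odd {ν} c i with remQuot {ν} 2 (odd' i) | remQuot-combine {ν} {2} i zero
... | .(i , zero) | refl = refl

Φ-even : ∀ {ν} (c : Word ν) i → Φ c (even' i) ≡ φ₂ (c i)
Φ-even {ν} c i with remQuot {ν} 2 (even' i) | remQuot-combine {ν} {2} i (suc zero)
... | .(i , suc zero) | refl = refl

pairwise : ∀ {ν} {P : Fin (ν * 2) → Set} → (∀ i → P (odd' i)) → (∀ i → P (even' i)) → ∀ j → P j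
pairwise {ν} {P} at-odd at-even j =
  subst P (combine-remQuot {ν} 2 j) (by-parity (proj₁ (remQuot {ν} 2 j)) (proj₂ (remQuot {ν} 2 j)))
  where
  by-parity : ∀ i k → P (combine i k)
  by-parity i zero = at-odd i
  by-parity i (suc zero) = at-even i

sumFin-mono : ∀ n {f g : Fin n → ℕ} → (∀ i → f i ≤ g i) → sumFin n f ≤ sumFin n g
sumFin-mono zero f≤g = z≤n
sumFin-mono (suc n) f≤g = ℕP.+-mono-≤ (f≤g zero) (sumFin-mono n (λ i → f≤g (suc i)))

sumFin-+ : ∀ n (f g : Fin n → ℕ) → sumFin n (λ i → f i + g i) ≡ sumFin n f + sumFin n g
sumFin-+ zero f g = refl
sumFin-+ (suc n) f g =
  trans (cong (_+_ (f zero + g zero)) (sumFin-+ n _ _)) (interchange (f zero) (g zero) _ _)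

term≤sumFin : ∀ n (f : Fin n → ℕ) i → f i ≤ sumFin n f
term≤sumFin (suc n) f zero = ℕP.m≤m+n _ _
term≤sumFin (suc n) f (suc i) = ℕP.≤-trans (term≤sumFin n (λ k → f (suc k)) i) (ℕP.m≤n+m _ _)

sumFin-pairs : ∀ ν (f : Fin (ν * 2) → ℕ) →
  sumFin (ν * 2) f ≡ sumFin ν (λ i → f (odd' i) + f (even' i))
sumFin-pairs zero f = refl
sumFin-pairs (suc ν) f =
  trans (sym (ℕP.+-assoc (f zero) (f (suc zero)) _))
        (cong (_+_ (f zero + f (suc zero))) (sumFin-pairs ν (λ j → f (suc (suc j)))))

δ : Fin 3 → Fin 3 → ℕ
δ a b with a ≟ b
... | yes _ = 0
... | no _ = 1

δ≤1 : ∀ a b → δ a b ≤ 1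
δ≤1 a b with a ≟ b
... | yes _ = z≤n
... | no _ = s≤s z≤n

δ-triangle : ∀ a b c → δ b c ≤ δ a b + δ a c
δ-triangle = from-yes (all? λ a → all? λ b → all? λ c → δ b c ≤? δ a b + δ a c)

hamming-sum : ∀ ν (x y : Word ν) → hamming x y ≡ sumFin ν (λ i → δ (x i) (y i))
hamming-sum zero x y = refl
hamming-sum (suc ν) x y with x zero ≟ y zero
... | yes _ = hamming-sum ν (λ i → x (suc i)) (λ i → y (suc i))
... | no _ = cong suc (hamming-sum ν (λ i → x (suc i)) (λ i → y (suc i)))

hamming-triangle : ∀ {ν} (w x y : Word ν) → hamming x y ≤ hamming w x + hamming w y
hamming-triangle {ν} w x y = begin
  hamming x y                                           ≡⟨ hamming-sum ν x y ⟩
  sumFin ν (λ i → δ (x i) (y i))                        ≤⟨ sumFin-mono ν (λ i → δ-triangle (w i) (x i) (y i)) ⟩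
  sumFin ν (λ i → δ (w i) (x i) + δ (w i) (y i))        ≡⟨ sumFin-+ ν _ _ ⟩
  sumFin ν (λ i → δ (w i) (x i)) + sumFin ν (λ i → δ (w i) (y i))
                                                        ≡⟨ sym (cong₂ _+_ (hamming-sum ν w x) (hamming-sum ν w y)) ⟩
  hamming w x + hamming w y                             ∎
  where open ℕP.≤-Reasoning

perfect-unique : ∀ {ν} {C : Code ν} → PerfectCode ν C → ∀ {w c c'} → C c → C c' →
  hamming w c ≤ 1 → hamming w c' ≤ 1 → ∀ i → c i ≡ c' i
perfect-unique (separated , _) {w} {c} {c'} Cc Cc' wc≤1 wc'≤1
  with all? (λ i → c i ≟ c' i)
... | yes c≡c' = c≡c'
... | no c≢c' = ⊥-elim (ℕP.<⇒≱ (s≤s (ℕP.+-mono-≤ wc≤1 wc'≤1))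
                         (ℕP.≤-trans (separated c c' Cc Cc' c≢c') (hamming-triangle w c c')))

ψ : Fin 3 → ℤ
ψ a = ρ (φ₁ a) (φ₂ a)

ψ-+ : ∀ a b → ψ a ℤ.+ ψ b ≡ ψ (a +₃ b) [mod + 12 ]
ψ-+ = from-yes (all? λ a → all? λ b → ψ a ℤ.+ ψ b ≡? ψ (a +₃ b) [mod + 12 ])

ψ-neg : ∀ a → ℤ.- ψ a ≡ ψ (suc (suc zero) *₃ a) [mod + 12 ]
ψ-neg = from-yes (all? λ a → ℤ.- ψ a ≡? ψ (suc (suc zero) *₃ a) [mod + 12 ])

-- X ≡ Φ(c) modulo Λ_n, read through ρ pair by pair.
OnClass : ∀ {ν} → Pt (ν * 2) → Word ν → Set
OnClass {ν} X c = ∀ i → ρ-at {ν} X i ≡ ψ (c i) [mod + 12 ]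

InT⇒OnClass : ∀ {ν} {C : Code ν} {X} → InT ν C X → ∃ λ c → C c × OnClass X c
InT⇒OnClass {X = X} (c , Y , Cc , (α , β , Y∈Λ) , X≡ΦY) = c , Cc , on-class
  where
  open ≡-Reasoning
  on-class : OnClass X c
  on-class i = congruent (subst (+ 12 ∣_) ρY≡ (Λ₂⇒12∣ρ (α i , β i , Y∈Λ i)))
    where
    X₁ = trans (X≡ΦY (odd' i)) (cong (ℤ._+ Y (odd' i)) (Φ-odd c i))
    X₂ = trans (X≡ΦY (even' i)) (cong (ℤ._+ Y (even' i)) (Φ-even c i))
    cancel : ∀ p y → y ≡ (p ℤ.+ y) ℤ.- p
    cancel = solve-∀
    ρY≡ : ρ-at Y i ≡ ρ-at X i ℤ.- ψ (c i)
    ρY≡ = begin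
      ρ-at Y i                                          ≡⟨ cancel (ψ (c i)) (ρ-at Y i) ⟩
      (ψ (c i) ℤ.+ ρ-at Y i) ℤ.- ψ (c i)                ≡⟨ cong (ℤ._- ψ (c i)) (sym (ρ-+ (φ₁ (c i)) (φ₂ (c i)) (Y (odd' i)) (Y (even' i)))) ⟩
      ρ (φ₁ (c i) ℤ.+ Y (odd' i)) (φ₂ (c i) ℤ.+ Y (even' i)) ℤ.- ψ (c i)
                                                        ≡⟨ cong₂ (λ x₁ x₂ → ρ x₁ x₂ ℤ.- ψ (c i)) (sym X₁) (sym X₂) ⟩
      ρ-at X i ℤ.- ψ (c i)                              ∎

OnClass⇒InT : ∀ {ν} {C : Code ν} {X} c → C c → OnClass X c → InT ν C X
OnClass⇒InT {ν} {X = X} c Cc on-class =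
  c , Y , Cc , ((λ i → proj₁ (pair∈Λ₂ i)) , (λ i → proj₁ (proj₂ (pair∈Λ₂ i))) , λ i → proj₂ (proj₂ (pair∈Λ₂ i))) ,
  λ j → split (X j) (Φ c j)
  where
  Y : Pt (ν * 2)
  Y j = X j ℤ.- Φ c j
  split : ∀ x p → x ≡ p ℤ.+ (x ℤ.- p)
  split = solve-∀
  pair∈Λ₂ : ∀ i → Λ₂ (Y (odd' i)) (Y (even' i))
  pair∈Λ₂ i = 12∣ρ⇒Λ₂ (subst (+ 12 ∣_) (sym ρY≡) (divides-difference (on-class i)))
    where
    ρY≡ : ρ-at Y i ≡ ρ-at X i ℤ.- ψ (c i)
    ρY≡ = trans (cong₂ (λ p q → ρ (X (odd' i) ℤ.- p) (X (even' i) ℤ.- q)) (Φ-odd c i) (Φ-even c i))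
                (ρ-- (X (odd' i)) (X (even' i)) (φ₁ (c i)) (φ₂ (c i)))

OnClass-+ : ∀ {ν} {X Y : Pt (ν * 2)} {c c' : Word ν} → OnClass X c → OnClass Y c' →
  OnClass (λ j → X j ℤ.+ Y j) (λ i → c i +₃ c' i)
OnClass-+ {X = X} {Y} {c} {c'} X-class Y-class i =
  mod-trans (mod-reflexive (ρ-+ (X (odd' i)) (X (even' i)) (Y (odd' i)) (Y (even' i))))
            (mod-trans (mod-+ (X-class i) (Y-class i)) (ψ-+ (c i) (c' i)))

OnClass-neg : ∀ {ν} {X : Pt (ν * 2)} {c : Word ν} → OnClass X c →
  OnClass (λ j → ℤ.- X j) (λ i → suc (suc zero) *₃ c i)
OnClass-neg {X = X} {c} X-class i =
  mod-trans (mod-reflexive (ρ-neg (X (odd' i)) (X (even' i))))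
            (mod-trans (mod-neg (X-class i)) (ψ-neg (c i)))

lattice : ∀ {ν} (C : Code ν) → Linear ν C → IsLattice (ν * 2) (InT ν C)
lattice {ν} C (C∋0 , C∋+ , C∋* ) = 0∈T , +∈T , -∈T , ≗-resp
  where
  0∈T : InT ν C (λ _ → + 0)
  0∈T = OnClass⇒InT (λ _ → zero) C∋0 (λ _ → mod-reflexive refl)
  +∈T : ∀ X Y → InT _ C X → InT _ C Y → InT _ C (λ j → X j ℤ.+ Y j)
  +∈T X Y X∈T Y∈T =
    let (c , Cc , X-class) = InT⇒OnClass X∈T
        (c' , Cc' , Y-class) = InT⇒OnClass Y∈T
    in OnClass⇒InT _ (C∋+ c c' Cc Cc') (OnClass-+ {X = X} {Y} {c} {c'} X-class Y-class)
  -∈T : ∀ X → InT _ C X → InT _ C (λ j → ℤ.- X j)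
  -∈T X X∈T =
    let (c , Cc , X-class) = InT⇒OnClass X∈T
    in OnClass⇒InT _ (C∋* (suc (suc zero)) c Cc) (OnClass-neg {X = X} {c} X-class)
  ≗-resp : ∀ X Y → (∀ j → X j ≡ Y j) → InT _ C X → InT _ C Y
  ≗-resp X Y X≗Y (c , Z , Cc , Z∈Λ , X≡ΦZ) = c , Z , Cc , Z∈Λ , λ j → trans (sym (X≗Y j)) (X≡ΦZ j)

Bit : ℤ → Set
Bit v = v ≡ -[1+ 0 ] ⊎ v ≡ + 0

pairDist : ℤ → ℤ → ℤ → ℤ → ℕ
pairDist v₁ v₂ u₁ u₂ = ∣ v₁ ℤ.- u₁ ∣ + ∣ v₂ ℤ.- u₂ ∣

-- (u₁, u₂) lies within ℓ¹-distance d of a corner; Near 1 is the tile Υ₂.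
record Near (d : ℕ) (u₁ u₂ : ℤ) : Set where
  constructor near
  field
    v₁ v₂ : ℤ
    corner₁ : Bit v₁
    corner₂ : Bit v₂
    within : pairDist v₁ v₂ u₁ u₂ ≤ d
open Near

Near-weaken : ∀ {d d' u₁ u₂} → d ≤ d' → Near d u₁ u₂ → Near d' u₁ u₂
Near-weaken d≤d' (near v₁ v₂ corner₁ corner₂ within) = near v₁ v₂ corner₁ corner₂ (ℕP.≤-trans within d≤d')

-- Fits x a u: a point of residue x is u plus a point of the class of φ(a).
record Fits (x : ℤ) (a : Fin 3) (u₁ u₂ : ℤ) : Set where
  constructor fits
  field
    residue : x ≡ ρ u₁ u₂ ℤ.+ ψ a [mod + 12 ]
open Fits

-- Finite encoding: corners are bit b, and a point of Υ₂ is a corner minus offsets step t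
-- with ∣step t₁∣ + ∣step t₂∣ ≤ 1.  The decoders turn Bit and ∣e∣ ≤ 1 into these codes.
bit : Fin 2 → ℤ
bit zero = + 0
bit (suc zero) = -[1+ 0 ]

step : Fin 3 → ℤ
step zero = + 0
step (suc zero) = + 1
step (suc (suc zero)) = -[1+ 0 ]

bit-decode : ∀ {v} → Bit v → ∃ λ b → v ≡ bit b
bit-decode (inj₁ refl) = suc zero , refl
bit-decode (inj₂ refl) = zero , refl

bit-Bit : ∀ b → Bit (bit b)
bit-Bit zero = inj₂ refl
bit-Bit (suc zero) = inj₁ refl

step-decode : ∀ e → ∣ e ∣ ≤ 1 → ∃ λ t → e ≡ step t
step-decode (+ 0) _ = zero , refl
step-decode (+ 1) _ = suc zero , refl
step-decode (+ suc (suc _)) (s≤s ())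
step-decode -[1+ 0 ] _ = suc (suc zero) , refl
step-decode -[1+ suc _ ] (s≤s ())

-- The two finite facts, checked by evaluating decision procedures over all codes.  They are
-- opaque so that using them never re-runs the decision procedures.
opaque
  -- Fact (b): the twelve sums ρ(corner) + ψ(a) are a complete residue system modulo 12.
  corner-residues-cover : ∀ (k : Fin 12) → ∃ λ a → ∃₂ λ b₁ b₂ →
    + toℕ k ≡ ρ (bit b₁) (bit b₂) ℤ.+ ψ a [mod + 12 ]
  corner-residues-cover = from-yes (all? λ (k : Fin 12) → any? λ a → any? λ b₁ → any? λ b₂ →
    + toℕ k ≡? ρ (bit b₁) (bit b₂) ℤ.+ ψ a [mod + 12 ])

  corner-residues-distinct : ∀ b₁ b₂ a b₁' b₂' a' →
    ρ (bit b₁) (bit b₂) ℤ.+ ψ a ≡ ρ (bit b₁') (bit b₂') ℤ.+ ψ a' [mod + 12 ] → a ≡ a'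
  corner-residues-distinct = from-yes (all? λ b₁ → all? λ b₂ → all? λ a → all? λ b₁' → all? λ b₂' → all? λ a' →
    (ρ (bit b₁) (bit b₂) ℤ.+ ψ a ≡? ρ (bit b₁') (bit b₂') ℤ.+ ψ a' [mod + 12 ]) →-dec (a ≟ a'))

  -- Fact (a): the twelve points of Υ₂ are a complete residue system modulo 12.
  Υ₂-residues-cover : ∀ (k : Fin 12) → ∃₂ λ b₁ b₂ → ∃₂ λ t₁ t₂ →
    ∣ step t₁ ∣ + ∣ step t₂ ∣ ≤ 1 × + toℕ k ≡ ρ (bit b₁ ℤ.- step t₁) (bit b₂ ℤ.- step t₂) [mod + 12 ]
  Υ₂-residues-cover = from-yes (all? λ (k : Fin 12) → any? λ b₁ → any? λ b₂ → any? λ t₁ → any? λ t₂ →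
    (∣ step t₁ ∣ + ∣ step t₂ ∣ ≤? 1) ×-dec (+ toℕ k ≡? ρ (bit b₁ ℤ.- step t₁) (bit b₂ ℤ.- step t₂) [mod + 12 ]))

  Υ₂-residues-distinct : ∀ b₁ b₂ t₁ t₂ b₁' b₂' t₁' t₂' →
    ∣ step t₁ ∣ + ∣ step t₂ ∣ ≤ 1 → ∣ step t₁' ∣ + ∣ step t₂' ∣ ≤ 1 →
    ρ (bit b₁ ℤ.- step t₁) (bit b₂ ℤ.- step t₂) ≡ ρ (bit b₁' ℤ.- step t₁') (bit b₂' ℤ.- step t₂') [mod + 12 ] →
    bit b₁ ℤ.- step t₁ ≡ bit b₁' ℤ.- step t₁' × bit b₂ ℤ.- step t₂ ≡ bit b₂' ℤ.- step t₂'
  Υ₂-residues-distinct = from-yes (all? λ b₁ → all? λ b₂ → all? λ t₁ → all? λ t₂ →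
    all? λ b₁' → all? λ b₂' → all? λ t₁' → all? λ t₂' →
    (∣ step t₁ ∣ + ∣ step t₂ ∣ ≤? 1) →-dec (∣ step t₁' ∣ + ∣ step t₂' ∣ ≤? 1) →-dec
    (ρ (bit b₁ ℤ.- step t₁) (bit b₂ ℤ.- step t₂) ≡? ρ (bit b₁' ℤ.- step t₁') (bit b₂' ℤ.- step t₂') [mod + 12 ]) →-dec
    ((bit b₁ ℤ.- step t₁ ℤ.≟ bit b₁' ℤ.- step t₁') ×-dec (bit b₂ ℤ.- step t₂ ℤ.≟ bit b₂' ℤ.- step t₂')))

Near-decode : ∀ {u₁ u₂} → Near 1 u₁ u₂ → ∃₂ λ b₁ b₂ → ∃₂ λ t₁ t₂ →
  ∣ step t₁ ∣ + ∣ step t₂ ∣ ≤ 1 × u₁ ≡ bit b₁ ℤ.- step t₁ × u₂ ≡ bit b₂ ℤ.- step t₂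
Near-decode {u₁} {u₂} (near v₁ v₂ corner₁ corner₂ within)
  with bit-decode corner₁ | bit-decode corner₂
     | step-decode (v₁ ℤ.- u₁) (ℕP.m+n≤o⇒m≤o _ within) | step-decode (v₂ ℤ.- u₂) (ℕP.m+n≤o⇒n≤o _ within)
... | b₁ , refl | b₂ , refl | t₁ , e₁ | t₂ , e₂ =
  b₁ , b₂ , t₁ , t₂ ,
  subst (_≤ 1) (cong₂ (λ e e' → ∣ e ∣ + ∣ e' ∣) e₁ e₂) within ,
  trans (sym (z-[z-u]≡u (bit b₁) u₁)) (cong (ℤ._-_ (bit b₁)) e₁) ,
  trans (sym (z-[z-u]≡u (bit b₂) u₂)) (cong (ℤ._-_ (bit b₂)) e₂)

Near-encode : ∀ {d} b₁ b₂ t₁ t₂ → ∣ step t₁ ∣ + ∣ step t₂ ∣ ≤ d →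
  Near d (bit b₁ ℤ.- step t₁) (bit b₂ ℤ.- step t₂)
Near-encode {d} b₁ b₂ t₁ t₂ norm≤d = near (bit b₁) (bit b₂) (bit-Bit b₁) (bit-Bit b₂)
  (subst (_≤ d) (sym (cong₂ _+_ (cong ∣_∣ (z-[z-u]≡u (bit b₁) (step t₁))) (cong ∣_∣ (z-[z-u]≡u (bit b₂) (step t₂))))) norm≤d)

corner-near : ∀ {d v₁ v₂} → Bit v₁ → Bit v₂ → Near d v₁ v₂
corner-near {d} {v₁} {v₂} corner₁ corner₂ = near v₁ v₂ corner₁ corner₂
  (subst (_≤ d) (sym (cong₂ _+_ (cong ∣_∣ (ℤP.+-inverseʳ v₁)) (cong ∣_∣ (ℤP.+-inverseʳ v₂)))) z≤n)

Near-zero : ∀ {u₁ u₂} → Near 0 u₁ u₂ → ∃₂ λ b₁ b₂ → u₁ ≡ bit b₁ × u₂ ≡ bit b₂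
Near-zero {u₁} {u₂} (near v₁ v₂ corner₁ corner₂ within)
  with bit-decode corner₁ | bit-decode corner₂
... | b₁ , refl | b₂ , refl = b₁ , b₂ , sym (at-corner (bit b₁) u₁ dist₁≡0) , sym (at-corner (bit b₂) u₂ dist₂≡0)
  where
  dist≡0 = ℕP.n≤0⇒n≡0 within
  dist₁≡0 = ℕP.m+n≡0⇒m≡0 _ dist≡0
  dist₂≡0 = ℕP.m+n≡0⇒n≡0 _ dist≡0
  at-corner : ∀ v u → ∣ v ℤ.- u ∣ ≡ 0 → v ≡ u
  at-corner v u ∣v-u∣≡0 = ℤP.i-j≡0⇒i≡j v u (ℤP.∣i∣≡0⇒i≡0 ∣v-u∣≡0)

corner-cover : ∀ x → ∃ λ a → ∃₂ λ b₁ b₂ → Fits x a (bit b₁) (bit b₂)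
corner-cover = residue-cover 12 (λ x → ∃ λ a → ∃₂ λ b₁ b₂ → Fits x a (bit b₁) (bit b₂))
  (λ x≡y (a , b₁ , b₂ , y-fits) → a , b₁ , b₂ , fits (mod-trans x≡y (residue y-fits)))
  (λ k → let (a , b₁ , b₂ , k≡) = corner-residues-cover k in a , b₁ , b₂ , fits k≡)

nearest : ℤ → Fin 3
nearest x = proj₁ (corner-cover x)

corner-unique : ∀ {x a b₁ b₂} → Fits x a (bit b₁) (bit b₂) → nearest x ≡ a
corner-unique {x} {a} {b₁} {b₂} (fits x≡) =
  let (a₀ , b₁₀ , b₂₀ , fits x≡₀) = corner-cover x
  in corner-residues-distinct b₁₀ b₂₀ a₀ b₁ b₂ a (mod-trans (mod-sym x≡₀) x≡)

Υ₂-cover : ∀ x → ∃₂ λ u₁ u₂ → Near 1 u₁ u₂ × x ≡ ρ u₁ u₂ [mod + 12 ]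
Υ₂-cover = residue-cover 12 (λ x → ∃₂ λ u₁ u₂ → Near 1 u₁ u₂ × x ≡ ρ u₁ u₂ [mod + 12 ])
  (λ x≡y (u₁ , u₂ , in-Υ₂ , y≡ρu) → u₁ , u₂ , in-Υ₂ , mod-trans x≡y y≡ρu)
  (λ k → let (b₁ , b₂ , t₁ , t₂ , norm≤1 , k≡ρu) = Υ₂-residues-cover k in
         _ , _ , Near-encode b₁ b₂ t₁ t₂ norm≤1 , k≡ρu)

record Cover (x : ℤ) (a : Fin 3) (d : ℕ) : Set where
  constructor cover
  field
    u₁ u₂ : ℤ
    fitting : Fits x a u₁ u₂
    cover-near : Near d u₁ u₂

-- For every residue x and symbol a some point of Υ₂ fits,
-- at distance δ(nearest x, a) from a corner: a corner itself if a is the nearest symbol,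
-- and otherwise the point of Υ₂ with residue x − ψ(a).  (δ makes the same test, so it
-- computes to 0 resp. 1 in the two cases.)
tile-exists : ∀ x a → Cover x a (δ (nearest x) a)
tile-exists x a with nearest x ≟ a
... | yes refl = let (_ , b₁ , b₂ , corner-fits) = corner-cover x in
  cover (bit b₁) (bit b₂) corner-fits (corner-near (bit-Bit b₁) (bit-Bit b₂))
... | no _ = let (u₁ , u₂ , in-Υ₂ , x-ψa≡ρu) = Υ₂-cover (x ℤ.- ψ a) in
  cover u₁ u₂ (fits (mod-move x-ψa≡ρu)) in-Υ₂

-- ... no point fits at a smaller distance (a corner fits only the nearest symbol) ...
tile-cost : ∀ {d x a u₁ u₂} → Near d u₁ u₂ → Fits x a u₁ u₂ → δ (nearest x) a ≤ d
tile-cost {suc d} {x} {a} _ _ = ℕP.≤-trans (δ≤1 (nearest x) a) (s≤s z≤n)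
tile-cost {zero} {x} {a} at-corner u-fits with nearest x ≟ a | Near-zero at-corner
... | yes _ | _ = z≤n
... | no nearest≢a | _ , _ , refl , refl = ⊥-elim (nearest≢a (corner-unique u-fits))

-- ... and at most one point of Υ₂ fits, by fact (a).
tile-unique : ∀ {x a u₁ u₂ u₁' u₂'} → Near 1 u₁ u₂ → Near 1 u₁' u₂' →
  Fits x a u₁ u₂ → Fits x a u₁' u₂' → u₁ ≡ u₁' × u₂ ≡ u₂'
tile-unique in-Υ₂ in-Υ₂' (fits x≡) (fits x≡') with Near-decode in-Υ₂ | Near-decode in-Υ₂'
... | b₁ , b₂ , t₁ , t₂ , norm≤1 , refl , refl | b₁' , b₂' , t₁' , t₂' , norm'≤1 , refl , refl =
  Υ₂-residues-distinct b₁ b₂ t₁ t₂ b₁' b₂' t₁' t₂' norm≤1 norm'≤1 (mod-cancelʳ (mod-trans (mod-sym x≡) x≡'))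

fits-of-class : ∀ {z₁ z₂ x₁ x₂ a} → ρ x₁ x₂ ≡ ψ a [mod + 12 ] →
  Fits (ρ z₁ z₂) a (z₁ ℤ.- x₁) (z₂ ℤ.- x₂)
fits-of-class {z₁} {z₂} {x₁} {x₂} {a} (congruent 12∣ρx-ψa) =
  fits (congruent (subst (+ 12 ∣_) (identity z₁ z₂ x₁ x₂ (ψ a)) 12∣ρx-ψa))
  where
  identity : ∀ z₁ z₂ x₁ x₂ p → (+ 2 ℤ.* x₁ ℤ.+ + 3 ℤ.* x₂) ℤ.- p
    ≡ (+ 2 ℤ.* z₁ ℤ.+ + 3 ℤ.* z₂) ℤ.- ((+ 2 ℤ.* (z₁ ℤ.- x₁) ℤ.+ + 3 ℤ.* (z₂ ℤ.- x₂)) ℤ.+ p)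
  identity = solve-∀

class-of-fits : ∀ {z₁ z₂ u₁ u₂ a} → Fits (ρ z₁ z₂) a u₁ u₂ →
  ρ (z₁ ℤ.- u₁) (z₂ ℤ.- u₂) ≡ ψ a [mod + 12 ]
class-of-fits {z₁} {z₂} {u₁} {u₂} {a} (fits (congruent 12∣difference)) =
  congruent (subst (+ 12 ∣_) (identity z₁ z₂ u₁ u₂ (ψ a)) 12∣difference)
  where
  identity : ∀ z₁ z₂ u₁ u₂ p → (+ 2 ℤ.* z₁ ℤ.+ + 3 ℤ.* z₂) ℤ.- ((+ 2 ℤ.* u₁ ℤ.+ + 3 ℤ.* u₂) ℤ.+ p)
    ≡ (+ 2 ℤ.* (z₁ ℤ.- u₁) ℤ.+ + 3 ℤ.* (z₂ ℤ.- u₂)) ℤ.- p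
  identity = solve-∀

InΥ⇒pairs : ∀ {ν} {U : Pt (ν * 2)} → InΥ (ν * 2) U →
  ∃ λ (d : Fin ν → ℕ) → sumFin ν d ≤ 1 × ∀ i → Near (d i) (U (odd' i)) (U (even' i))
InΥ⇒pairs {ν} {U} (V , corners , Σ≤1) =
  (λ i → pairDist (V (odd' i)) (V (even' i)) (U (odd' i)) (U (even' i))) ,
  subst (_≤ 1) (sumFin-pairs ν (λ j → ∣ V j ℤ.- U j ∣)) Σ≤1 ,
  λ i → near _ _ (corners (odd' i)) (corners (even' i)) ℕP.≤-refl

pairs⇒InΥ : ∀ {ν} {U : Pt (ν * 2)} (d : Fin ν → ℕ) → sumFin ν d ≤ 1 →
  (∀ i → Near (d i) (U (odd' i)) (U (even' i))) → InΥ (ν * 2) U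
pairs⇒InΥ {ν} {U} d Σd≤1 pair-near = V , corners , Σ≤1
  where
  V : Pt (ν * 2)
  V = fromPairs (λ i → v₁ (pair-near i)) (λ i → v₂ (pair-near i))
  corners : ∀ j → Bit (V j)
  corners = pairwise (λ i → subst Bit (sym (fromPairs-odd _ _ i)) (corner₁ (pair-near i)))
                     (λ i → subst Bit (sym (fromPairs-even _ _ i)) (corner₂ (pair-near i)))
  pair≤d : ∀ i → pairDist (V (odd' i)) (V (even' i)) (U (odd' i)) (U (even' i)) ≤ d i
  pair≤d i = subst₂ (λ v₁ v₂ → pairDist v₁ v₂ (U (odd' i)) (U (even' i)) ≤ d i)
                    (sym (fromPairs-odd _ _ i)) (sym (fromPairs-even _ _ i)) (within (pair-near i))
  Σ≤1 : sumFin (ν * 2) (λ j → ∣ V j ℤ.- U j ∣) ≤ 1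
  Σ≤1 = ℕP.≤-trans (ℕP.≤-reflexive (sumFin-pairs ν _)) (ℕP.≤-trans (sumFin-mono ν pair≤d) Σd≤1)

module Tiling {ν : ℕ} (C : Code ν) (perfect : PerfectCode ν C) where

  received : Pt (ν * 2) → Word ν
  received Z i = nearest (ρ-at Z i)

  -- Existence: decode the received word to a codeword c at distance ≤ 1 and, pair by pair,
  -- subtract from Z the point of Υ₂ that fits Z's residue and cᵢ.
  existence : ∀ Z → ∃ λ X → InT ν C X × InΥ (ν * 2) (λ j → Z j ℤ.- X j)
  existence Z = X , OnClass⇒InT c Cc X-class , pairs⇒InΥ d Σd≤1 pair-near
    where
    open Cover
    decoded = proj₂ perfect (received Z)
    c = proj₁ decoded
    Cc = proj₁ (proj₂ decoded)
    d : Fin ν → ℕ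
    d i = δ (received Z i) (c i)
    Σd≤1 : sumFin ν d ≤ 1
    Σd≤1 = subst (_≤ 1) (hamming-sum ν (received Z) c) (proj₂ (proj₂ decoded))
    tile : ∀ i → Cover (ρ-at Z i) (c i) (d i)
    tile i = tile-exists (ρ-at Z i) (c i)
    x₁ x₂ : Fin ν → ℤ
    x₁ i = Z (odd' i) ℤ.- u₁ (tile i)
    x₂ i = Z (even' i) ℤ.- u₂ (tile i)
    X : Pt (ν * 2)
    X = fromPairs x₁ x₂
    X-class : OnClass X c
    X-class i = subst (λ r → r ≡ ψ (c i) [mod + 12 ])
      (sym (cong₂ ρ (fromPairs-odd x₁ x₂ i) (fromPairs-even x₁ x₂ i)))
      (class-of-fits {Z (odd' i)} {Z (even' i)} (fitting (tile i)))
    pair-near : ∀ i → Near (d i) (Z (odd' i) ℤ.- X (odd' i)) (Z (even' i) ℤ.- X (even' i))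
    pair-near i = subst₂ (Near (d i))
      (trans (sym (z-[z-u]≡u (Z (odd' i)) (u₁ (tile i)))) (cong (ℤ._-_ (Z (odd' i))) (sym (fromPairs-odd x₁ x₂ i))))
      (trans (sym (z-[z-u]≡u (Z (even' i)) (u₂ (tile i)))) (cong (ℤ._-_ (Z (even' i))) (sym (fromPairs-even x₁ x₂ i))))
      (cover-near (tile i))

  record Placement (Z X : Pt (ν * 2)) : Set where
    field
      word : Word ν
      word∈C : C word
      close : hamming (received Z) word ≤ 1
      pair-in-Υ₂ : ∀ (i : Fin ν) → Near 1 (Z (odd' i) ℤ.- X (odd' i)) (Z (even' i) ℤ.- X (even' i))
      pair-fits : ∀ (i : Fin ν) → Fits (ρ-at Z i) (word i) (Z (odd' i) ℤ.- X (odd' i)) (Z (even' i) ℤ.- X (even' i))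

  placement : ∀ {Z X} → InT ν C X → InΥ (ν * 2) (λ j → Z j ℤ.- X j) → Placement Z X
  placement {Z} {X} X∈T Z∈X+Υ with InT⇒OnClass X∈T | InΥ⇒pairs Z∈X+Υ
  ... | c , Cc , X-class | d , Σd≤1 , pair-near = record
    { word = c
    ; word∈C = Cc
    ; close = ℕP.≤-trans (ℕP.≤-reflexive (hamming-sum ν (received Z) c))
                (ℕP.≤-trans (sumFin-mono ν (λ i → tile-cost (pair-near i) (pair-fits i))) Σd≤1)
    ; pair-in-Υ₂ = λ i → Near-weaken (ℕP.≤-trans (term≤sumFin ν d i) Σd≤1) (pair-near i)
    ; pair-fits = pair-fits
    }
    where
    pair-fits : ∀ (i : Fin ν) → Fits (ρ-at Z i) (c i) (Z (odd' i) ℤ.- X (odd' i)) (Z (even' i) ℤ.- X (even' i))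
    pair-fits i = fits-of-class {Z (odd' i)} {Z (even' i)} (X-class i)

  -- Uniqueness: both translates carry the same codeword (perfection), hence the same point
  -- of Υ₂ in every pair (tile-unique).
  uniqueness : ∀ Z X X' → InT ν C X → InT ν C X' → InΥ (ν * 2) (λ j → Z j ℤ.- X j) →
    InΥ (ν * 2) (λ j → Z j ℤ.- X' j) → ∀ j → X j ≡ X' j
  uniqueness Z X X' X∈T X'∈T Z∈X+Υ Z∈X'+Υ =
    pairwise (λ i → proj₁ (same-pair i)) (λ i → proj₂ (same-pair i))
    where
    open Placement
    P : Placement Z X
    P = placement {Z} X∈T Z∈X+Υ
    P' : Placement Z X'
    P' = placement {Z} X'∈T Z∈X'+Υ
    same-word : ∀ i → word P i ≡ word P' i
    same-word = perfect-unique perfect (word∈C P) (word∈C P') (close P) (close P')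
    recover : ∀ z {x x'} → z ℤ.- x ≡ z ℤ.- x' → x ≡ x'
    recover z {x} {x'} e = trans (sym (z-[z-u]≡u z x)) (trans (cong (ℤ._-_ z) e) (z-[z-u]≡u z x'))
    same-pair : ∀ i → X (odd' i) ≡ X' (odd' i) × X (even' i) ≡ X' (even' i)
    same-pair i =
      let (e₁ , e₂) = tile-unique (pair-in-Υ₂ P i) (pair-in-Υ₂ P' i) (pair-fits P i)
                        (subst (λ a → Fits (ρ-at Z i) a (Z (odd' i) ℤ.- X' (odd' i)) (Z (even' i) ℤ.- X' (even' i)))
                               (sym (same-word i)) (pair-fits P' i))
      in recover (Z (odd' i)) e₁ , recover (Z (even' i)) e₂

-- Theorem 9.  The hypotheses on t only say that a perfect ternary code of length ν can exist;
-- the argument uses the code C itself.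
theorem9 : (t : ℕ) → 0 < t → (ν : ℕ) → 2 * ν + 1 ≡ 3 ^ t
    → (C : Code ν) → PerfectCode ν C → Linear ν C
    → IsLattice (ν * 2) (InT ν C) × IntegerTiling (ν * 2) (InT ν C)
theorem9 _ _ ν _ C perfect linear =
  lattice C linear , Tiling.existence C perfect , Tiling.uniqueness C perfect
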